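{- Let $1\le a\le b$. For any toggle-symmetric probability distribution $\mu$ on $J(\mathscr T(a,b))$, $$\sum_{i=1}^{a}(a-i)\,\mathbb E\big[\mu;\mathcal T^-_{(i,i)}\big]-\sum_{(i,j):\ i<j\le a}\mathbb E\big[\mu;\mathcal T^-_{(i,j)}\big]=0.$$
   Context: $\mathscr T(a,b)=\{(i,j)\in\mathbb Z^2:1\le i\le a,\ i\le j\le a+b-i\}$ with componentwise order. For an element $p$ and order ideal $I$: $\mathcal T_p^+(I)=1$ if $p\notin I$ and $I\cup\{p\}$ is an order ideal (else $0$); $\mathcal T_p^-(I)=1$ if $p\in I$ and $I\setminus\{p\}$ is an order ideal, i.e. $p$ is a maximal element of $I$ (else $0$); $\mathcal T_p=\mathcal T_p^+-\mathcal T_p^-$. A distribution $\mu$ on $J(\mathscr T(a,b))$ is toggle-symmetric if $\mathbb E[\mu;\mathcal T_p]=0$ for all $p$.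
   Formalization: The toggle-symmetric probability distribution μ takes rational values on $J(\mathscr T(a,b))$. -}

module Defs where

open import Data.Bool using (Bool; true; false; _∧_; _∨_; not; T)
open import Data.Nat using (ℕ; zero; suc; _+_; _∸_; _≤_; _<_; _≤ᵇ_; _≡ᵇ_)
open import Data.Integer using (+_)
open import Data.Rational using (ℚ; 0ℚ; 1ℚ; _/_)
import Data.Rational as Q
open import Data.List using (List; []; _∷_; map; concatMap; upTo; foldr)
open import Data.Bool.ListAction using (all)
open import Data.Product using (_×_; _,_; proj₁; proj₂; Σ)
open import Relation.Binary.PropositionalEquality using (_≡_)

Pt : Set
Pt = ℕ × ℕ

InT : ℕ → ℕ → Pt → Set
InT a b (i , j) = (1 ≤ i) × (i ≤ a) × (i ≤ j) × (j ≤ a + b ∸ i)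

-- [lo .. hi] (empty if hi < lo)
range : ℕ → ℕ → List ℕ
range lo hi = map (λ k → lo + k) (upTo (suc hi ∸ lo))

points : ℕ → ℕ → List Pt
points a b = concatMap (λ i → map (λ j → (i , j)) (range i (a + b ∸ i))) (range 1 a)

_≤ₚ_ : Pt → Pt → Bool
(i , j) ≤ₚ (k , l) = (i ≤ᵇ k) ∧ (j ≤ᵇ l)

_≡ₚ_ : Pt → Pt → Bool
(i , j) ≡ₚ (k , l) = (i ≡ᵇ k) ∧ (j ≡ᵇ l)

Subset : Set
Subset = Pt → Bool

isIdealᵇ : ℕ → ℕ → Subset → Bool
isIdealᵇ a b S =
  all (λ r → not (S r) ∨ all (λ q → not (q ≤ₚ r) ∨ S q) (points a b)) (points a b)

record Ideal (a b : ℕ) : Set where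
  field
    mem    : Subset
    sub    : ∀ p → mem p ≡ true → InT a b p
    closed : T (isIdealᵇ a b mem)
open Ideal public

insert remove : Pt → Subset → Subset
insert p S q = (q ≡ₚ p) ∨ S q
remove p S q = not (q ≡ₚ p) ∧ S q

indicator : Bool → ℚ
indicator true  = 1ℚ
indicator false = 0ℚ

-- 𝒯⁺_p(I) = 1 iff p ∉ I and I ∪ {p} is an order ideal of 𝒯(a,b)
-- (p is assumed to be an element of 𝒯(a,b)).
Tplus : (a b : ℕ) → Pt → Ideal a b → ℚ
Tplus a b p I = indicator (not (mem I p) ∧ isIdealᵇ a b (insert p (mem I)))

Tminus : (a b : ℕ) → Pt → Ideal a b → ℚ
Tminus a b p I = indicator (mem I p ∧ isIdealᵇ a b (remove p (mem I)))

Ttog : (a b : ℕ) → Pt → Ideal a b → ℚ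
Ttog a b p I = Tplus a b p I Q.- Tminus a b p I

-- A probability distribution on J(𝒯(a,b)) with rational weights, given as
-- a finite list of (ideal , weight) pairs (every distribution on the finite
-- set J(𝒯(a,b)) is of this form; repeated ideals just add their weights).
Dist : ℕ → ℕ → Set
Dist a b = List (Ideal a b × ℚ)

sumℚ : List ℚ → ℚ
sumℚ = foldr Q._+_ 0ℚ

IsProbability : ∀ {a b} → Dist a b → Set
IsProbability μ =
  (∀ {x} → x Data.List.Membership.Propositional.∈ μ → 0ℚ Q.≤ proj₂ x)
  × sumℚ (map proj₂ μ) ≡ 1ℚ
  where import Data.List.Membership.Propositional

E : ∀ {a b} → Dist a b → (Ideal a b → ℚ) → ℚ
E μ f = sumℚ (map (λ x → proj₂ x Q.* f (proj₁ x)) μ)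

ToggleSymmetric : (a b : ℕ) → Dist a b → Set
ToggleSymmetric a b μ = ∀ p → InT a b p → E μ (Ttog a b p) ≡ 0ℚ

ℕtoℚ : ℕ → ℚ
ℕtoℚ n = + n / 1

diagSum : (a b : ℕ) → Dist a b → ℚ
diagSum a b μ = sumℚ (map (λ i → ℕtoℚ (a ∸ i) Q.* E μ (Tminus a b (i , i))) (range 1 a))

offSum : (a b : ℕ) → Dist a b → ℚ
offSum a b μ =
  sumℚ (concatMap (λ i → map (λ j → E μ (Tminus a b (i , j))) (range (suc i) a)) (range 1 a))

{-# OPTIONS --safe #-}
-- At an ideal I, the left-hand side (before taking expectations) equals
-- Σ_{i<j≤a} (a+1-j) 𝒯_{(i,j)}(I), whose expectation vanishes by toggle symmetry.
-- For this pointwise identity, summation by parts turns the terms of row i into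
-- Σ_{i≤j<a} (a-j) (𝒯⁻_{(i,j)} - 𝒯⁺_{(i,j+1)}). Since a ≤ b the triangle i ≤ j ≤ a lies in 𝒯(a,b),
-- where (i,j) is removable iff (i,j+1), (i+1,j) ∉ I, and (i,j+1) is addable iff (i,j), (i-1,j+1) ∈ I.
-- Hence 𝒯⁻_{(i,j)} - 𝒯⁺_{(i,j+1)} = X_i(j) - X_{i+1}(j) for X_i(j) = [(i,j) ∈ I and (i-1,j+1) ∉ I],
-- with row 0 counted as full; summed over i this telescopes to zero, as X_1 = 0 and row a+1 is empty.
module Submission where

open import Defs
open import Data.Nat using (ℕ; _≤_)
open import Data.Rational using (0ℚ; _-_)
open import Relation.Binary.PropositionalEquality using (_≡_)

open import Data.Bool using (Bool; true; false; _∧_; _∨_; not; T)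
open import Data.Bool.Properties using (T-≡; T-∧; T-∨; ∧-zeroʳ)
open import Data.Empty using (⊥-elim)
open import Data.Integer using (1ℤ)
import Data.Integer as ℤ
import Data.Integer.Properties as ℤ
open import Data.List using (List; []; _∷_; map; concatMap; applyUpTo; _++_)
import Data.List.Properties as List
open import Data.List.Membership.Propositional using (_∈_; find; lose)
open import Data.List.Membership.Propositional.Properties
  using (∈-map⁺; ∈-map⁻; ∈-concatMap⁺; ∈-concatMap⁻; ∈-upTo⁺; ∈-upTo⁻)
import Data.List.Relation.Unary.All as All
open import Data.List.Relation.Unary.All.Properties using (all⁺; all⁻)

import Data.Nat as ℕ
open import Data.Nat using (zero; suc; pred; _∸_; _<_; _≡ᵇ_; z≤n; s≤s)
open import Data.Nat.Coprimality using (Coprime; 1-coprimeTo) renaming (sym to coprime-sym)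
open import Data.Nat.Properties
  using ( _≟_; n≮n; ≤-refl; ≤-trans; ≤-pred; m<m+n; <⇒≤; n≤1+n; m≤m+n; 1+n≢n; m≤n⇒m<n∨m≡n; ≤⇒≤ᵇ; ≤ᵇ⇒≤; ≡⇒≡ᵇ; ≡ᵇ⇒≡
        ; ∸-monoʳ-≤; ∸-monoˡ-<; +-∸-assoc; m+[n∸m]≡n; m≤n⇒m∸n≡0; pred[m∸n]≡m∸[1+n]; 0∸n≡0; +-suc
        ; +-identityʳ)
open import Data.Product using (_×_; _,_; proj₁; proj₂)
open import Data.Product.Properties using (≡-dec)
open import Data.Rational using (ℚ; 1ℚ; mkℚ; _+_; _*_; _/_)
import Data.Rational.Properties as ℚ
open import Data.Rational.Solver using (module +-*-Solver)
open import Data.Sum using (_⊎_; inj₁; inj₂; [_,_])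
open import Data.Unit using (tt)
open import Function using (_⇔_; mk⇔; Equivalence; id)
open import Relation.Binary.Definitions using (DecidableEquality)
open import Relation.Binary.PropositionalEquality using (_≢_; refl; sym; trans; cong; cong₂; subst; module ≡-Reasoning)
open import Relation.Nullary using (¬_; yes; no)

open Equivalence using (to; from)
open ≡-Reasoning
open +-*-Solver using (solve; _:+_; _:*_; _:-_; _:=_; con)

T-not : ∀ {x} → T (not x) ⇔ (¬ T x)
T-not {false} = mk⇔ (λ _ ()) (λ _ → tt)
T-not {true}  = mk⇔ (λ ()) (λ ¬t → ¬t tt)

T-not-∨ : ∀ {x y} → T (not x ∨ y) ⇔ (T x → T y)
T-not-∨ {false} = mk⇔ (λ _ ()) (λ _ → tt)
T-not-∨ {true}  = mk⇔ (λ t _ → t) (λ f → f tt)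

T-⇔⇒≡ : ∀ {x y} → T x ⇔ T y → x ≡ y
T-⇔⇒≡ {false} {false} _ = refl
T-⇔⇒≡ {false} {true}  e = ⊥-elim (from e tt)
T-⇔⇒≡ {true}  {false} e = ⊥-elim (to e tt)
T-⇔⇒≡ {true}  {true}  _ = refl

ℕtoℚ-suc : ∀ n → ℕtoℚ (suc n) ≡ 1ℚ + ℕtoℚ n
ℕtoℚ-suc n = begin
  ℕtoℚ (suc n)                        ≡⟨ ℚ./-cong (cong (λ z → 1ℤ ℤ.+ z) (sym (ℤ.*-identityʳ (ℤ.+ n)))) refl ⟩
  (1ℤ ℤ.* 1ℤ ℤ.+ ℤ.+ n ℤ.* 1ℤ) / 1    ≡⟨⟩
  1ℚ + mkℚ (ℤ.+ n) 0 coprime          ≡⟨ cong (1ℚ +_) (sym (ℚ.normalize-coprime coprime)) ⟩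
  1ℚ + ℕtoℚ n                         ∎
  where
    coprime : Coprime n 1
    coprime = coprime-sym (1-coprimeTo n)

∑ : ℕ → ℕ → (ℕ → ℚ) → ℚ
∑ lo zero    f = 0ℚ
∑ lo (suc n) f = f lo + ∑ (suc lo) n f

∑-cong : ∀ {f g : ℕ → ℚ} lo n → (∀ k → lo ≤ k → k < lo ℕ.+ n → f k ≡ g k) → ∑ lo n f ≡ ∑ lo n g
∑-cong lo zero    _  = refl
∑-cong lo (suc n) eq = cong₂ _+_ (eq lo ≤-refl (m<m+n lo (s≤s z≤n)))
  (∑-cong (suc lo) n λ k lo<k k< → eq k (<⇒≤ lo<k) (subst (k <_) (sym (+-suc lo n)) k<))

∑-zero : ∀ lo n → ∑ lo n (λ _ → 0ℚ) ≡ 0ℚ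
∑-zero lo zero    = refl
∑-zero lo (suc n) = cong (0ℚ +_) (∑-zero (suc lo) n)

∑-+ : ∀ (f g : ℕ → ℚ) lo n → ∑ lo n (λ k → f k + g k) ≡ ∑ lo n f + ∑ lo n g
∑-+ f g lo zero    = refl
∑-+ f g lo (suc n) = trans (cong (f lo + g lo +_) (∑-+ f g (suc lo) n))
  (solve 4 (λ x y u v → (x :+ y) :+ (u :+ v) := (x :+ u) :+ (y :+ v)) refl
           (f lo) (g lo) (∑ (suc lo) n f) (∑ (suc lo) n g))

∑-- : ∀ (f g : ℕ → ℚ) lo n → ∑ lo n (λ k → f k - g k) ≡ ∑ lo n f - ∑ lo n g
∑-- f g lo zero    = refl
∑-- f g lo (suc n) = trans (cong (f lo - g lo +_) (∑-- f g (suc lo) n))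
  (solve 4 (λ x y u v → (x :- y) :+ (u :- v) := (x :+ u) :- (y :+ v)) refl
           (f lo) (g lo) (∑ (suc lo) n f) (∑ (suc lo) n g))

∑-telescope : ∀ (Y : ℕ → ℚ) lo n → ∑ lo n (λ k → Y k - Y (suc k)) ≡ Y lo - Y (lo ℕ.+ n)
∑-telescope Y lo zero rewrite +-identityʳ lo = sym (ℚ.+-inverseʳ (Y lo))
∑-telescope Y lo (suc n) rewrite +-suc lo n = trans (cong (Y lo - Y (suc lo) +_) (∑-telescope Y (suc lo) n))
  (solve 3 (λ x y z → (x :- y) :+ (y :- z) := x :- z) refl (Y lo) (Y (suc lo)) (Y (suc (lo ℕ.+ n))))

∑-dropZeroHead : ∀ (f : ℕ → ℚ) lo n → f lo ≡ 0ℚ → ∑ lo n f ≡ ∑ (suc lo) (pred n) f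
∑-dropZeroHead f lo zero    _   = refl
∑-dropZeroHead f lo (suc n) f≡0 = trans (cong (_+ ∑ (suc lo) n f) f≡0) (ℚ.+-identityˡ _)

∑-shift : ∀ (f : ℕ → ℚ) c lo n → ∑ lo n (λ k → f (c ℕ.+ k)) ≡ ∑ (c ℕ.+ lo) n f
∑-shift f c lo zero    = refl
∑-shift f c lo (suc n) = cong (f (c ℕ.+ lo) +_) (trans (∑-shift f c (suc lo) n) (cong (λ m → ∑ m n f) (+-suc c lo)))

sumℚ-applyUpTo : ∀ (f : ℕ → ℚ) n → sumℚ (applyUpTo f n) ≡ ∑ 0 n f
sumℚ-applyUpTo f zero    = refl
sumℚ-applyUpTo f (suc n) = cong (f 0 +_) (trans (sumℚ-applyUpTo (λ k → f (suc k)) n) (∑-shift f 1 0 n))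

sumℚ-map-range : ∀ (f : ℕ → ℚ) lo hi → sumℚ (map f (range lo hi)) ≡ ∑ lo (suc hi ∸ lo) f
sumℚ-map-range f lo hi = begin
  sumℚ (map f (map (lo ℕ.+_) (applyUpTo id n)))  ≡⟨ cong sumℚ (sym (List.map-∘ (applyUpTo id n))) ⟩
  sumℚ (map (λ k → f (lo ℕ.+ k)) (applyUpTo id n)) ≡⟨ cong sumℚ (List.map-applyUpTo id _ n) ⟩
  sumℚ (applyUpTo (λ k → f (lo ℕ.+ k)) n)         ≡⟨ sumℚ-applyUpTo _ n ⟩
  ∑ 0 n (λ k → f (lo ℕ.+ k))                       ≡⟨ ∑-shift f lo 0 n ⟩
  ∑ (lo ℕ.+ 0) n f                                 ≡⟨ cong (λ m → ∑ m n f) (+-identityʳ lo) ⟩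
  ∑ lo n f                                         ∎
  where
    n : ℕ
    n = suc hi ∸ lo

sumℚ-++ : ∀ xs ys → sumℚ (xs ++ ys) ≡ sumℚ xs + sumℚ ys
sumℚ-++ []       ys = sym (ℚ.+-identityˡ (sumℚ ys))
sumℚ-++ (x ∷ xs) ys = trans (cong (x +_) (sumℚ-++ xs ys)) (sym (ℚ.+-assoc x (sumℚ xs) (sumℚ ys)))

sumℚ-concatMap : ∀ {A : Set} (f : A → List ℚ) xs → sumℚ (concatMap f xs) ≡ sumℚ (map (λ x → sumℚ (f x)) xs)
sumℚ-concatMap f []       = refl
sumℚ-concatMap f (x ∷ xs) = trans (sumℚ-++ (f x) (concatMap f xs)) (cong (sumℚ (f x) +_) (sumℚ-concatMap f xs))

module _ {a b : ℕ} where

  E-cong : ∀ (μ : Dist a b) {f g : Ideal a b → ℚ} → (∀ I → f I ≡ g I) → E μ f ≡ E μ g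
  E-cong []            _  = refl
  E-cong ((I , w) ∷ μ) eq = cong₂ _+_ (cong (w *_) (eq I)) (E-cong μ eq)

  E-zero : ∀ (μ : Dist a b) → E μ (λ _ → 0ℚ) ≡ 0ℚ
  E-zero []            = refl
  E-zero ((I , w) ∷ μ) = trans (cong₂ _+_ (ℚ.*-zeroʳ w) (E-zero μ)) (ℚ.+-identityˡ 0ℚ)

  E-+ : ∀ (μ : Dist a b) f g → E μ (λ I → f I + g I) ≡ E μ f + E μ g
  E-+ []            f g = refl
  E-+ ((I , w) ∷ μ) f g = trans (cong (w * (f I + g I) +_) (E-+ μ f g))
    (solve 5 (λ w x y u v → w :* (x :+ y) :+ (u :+ v) := (w :* x :+ u) :+ (w :* y :+ v)) refl
             w (f I) (g I) (E μ f) (E μ g))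

  E-- : ∀ (μ : Dist a b) f g → E μ (λ I → f I - g I) ≡ E μ f - E μ g
  E-- []            f g = refl
  E-- ((I , w) ∷ μ) f g = trans (cong (w * (f I - g I) +_) (E-- μ f g))
    (solve 5 (λ w x y u v → w :* (x :- y) :+ (u :- v) := (w :* x :+ u) :- (w :* y :+ v)) refl
             w (f I) (g I) (E μ f) (E μ g))

  E-scale : ∀ (μ : Dist a b) c f → E μ (λ I → c * f I) ≡ c * E μ f
  E-scale []            c f = sym (ℚ.*-zeroʳ c)
  E-scale ((I , w) ∷ μ) c f = trans (cong (w * (c * f I) +_) (E-scale μ c f))
    (solve 4 (λ w c x u → w :* (c :* x) :+ c :* u := c :* (w :* x :+ u)) refl w c (f I) (E μ f))

  E-∑ : ∀ (μ : Dist a b) (f : ℕ → Ideal a b → ℚ) lo n → E μ (λ I → ∑ lo n (λ k → f k I)) ≡ ∑ lo n (λ k → E μ (f k))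
  E-∑ μ f lo zero    = E-zero μ
  E-∑ μ f lo (suc n) =
    trans (E-+ μ (f lo) (λ I → ∑ (suc lo) n (λ k → f k I))) (cong (E μ (f lo) +_) (E-∑ μ f (suc lo) n))

summation-by-parts : ∀ (u v : ℕ → ℚ) a lo n → a ∸ lo ≡ n →
  ℕtoℚ (a ∸ lo) * u lo - ∑ (suc lo) n u ≡
  ∑ (suc lo) n (λ j → ℕtoℚ (suc a ∸ j) * (v j - u j)) + ∑ lo n (λ j → ℕtoℚ (a ∸ j) * (u j - v (suc j)))
summation-by-parts u v a lo zero    a∸lo≡0 rewrite a∸lo≡0 = cong (_- 0ℚ) (ℚ.*-zeroˡ (u lo))
summation-by-parts u v a lo (suc n) a∸lo≡1+n = begin
  W * u₀ - (u₁ + ∑u)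
    ≡⟨ cong (λ w → w * u₀ - (u₁ + ∑u)) W≡1+N ⟩
  (1ℚ + N) * u₀ - (u₁ + ∑u)
    ≡⟨ solve 5 (λ N u₀ u₁ v₁ ∑u → (con 1ℚ :+ N) :* u₀ :- (u₁ :+ ∑u)
                  := ((con 1ℚ :+ N) :* (v₁ :- u₁) :+ (con 1ℚ :+ N) :* (u₀ :- v₁)) :+ (N :* u₁ :- ∑u))
               refl N u₀ u₁ v₁ ∑u ⟩
  ((1ℚ + N) * (v₁ - u₁) + (1ℚ + N) * (u₀ - v₁)) + (N * u₁ - ∑u)
    ≡⟨ cong₂ _+_ (cong (λ w → w * (v₁ - u₁) + w * (u₀ - v₁)) (sym W≡1+N)) IH ⟩
  (W * (v₁ - u₁) + W * (u₀ - v₁)) + (∑t + ∑c)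
    ≡⟨ solve 4 (λ x y z t → (x :+ y) :+ (z :+ t) := (x :+ z) :+ (y :+ t)) refl (W * (v₁ - u₁)) (W * (u₀ - v₁)) ∑t ∑c ⟩
  (W * (v₁ - u₁) + ∑t) + (W * (u₀ - v₁) + ∑c)
    ∎
  where
    a∸1+lo≡n : a ∸ suc lo ≡ n
    a∸1+lo≡n = trans (sym (pred[m∸n]≡m∸[1+n] a lo)) (cong pred a∸lo≡1+n)
    W N u₀ u₁ v₁ ∑u ∑t ∑c : ℚ
    W = ℕtoℚ (a ∸ lo)
    N = ℕtoℚ (a ∸ suc lo)
    u₀ = u lo
    u₁ = u (suc lo)
    v₁ = v (suc lo)
    ∑u = ∑ (suc (suc lo)) n u
    ∑t = ∑ (suc (suc lo)) n (λ j → ℕtoℚ (suc a ∸ j) * (v j - u j))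
    ∑c = ∑ (suc lo) n (λ j → ℕtoℚ (a ∸ j) * (u j - v (suc j)))
    W≡1+N : W ≡ 1ℚ + N
    W≡1+N = trans (cong ℕtoℚ (trans a∸lo≡1+n (cong suc (sym a∸1+lo≡n)))) (ℕtoℚ-suc (a ∸ suc lo))
    IH : N * u₁ - ∑u ≡ ∑t + ∑c
    IH = summation-by-parts u v a (suc lo) n a∸1+lo≡n

indicator-identity : ∀ A B C Q → (T C → T A) → (T B → T Q) →
  indicator (A ∧ (not B ∧ not C)) - indicator (not B ∧ (A ∧ Q)) ≡ indicator (not Q ∧ A) - indicator (not B ∧ C)
indicator-identity false _     true  _     C⇒A _   = ⊥-elim (C⇒A tt)
indicator-identity true  true  _     false _   B⇒Q = ⊥-elim (B⇒Q tt)
indicator-identity false false false false _   _   = refl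
indicator-identity false false false true  _   _   = refl
indicator-identity false true  false false _   _   = refl
indicator-identity false true  false true  _   _   = refl
indicator-identity true  true  false true  _   _   = refl
indicator-identity true  true  true  true  _   _   = refl
indicator-identity true  false false false _   _   = refl
indicator-identity true  false false true  _   _   = refl
indicator-identity true  false true  false _   _   = refl
indicator-identity true  false true  true  _   _   = refl

infix 4 _⊑_ _≟ₚ_

_⊑_ : Pt → Pt → Set
(k , l) ⊑ (i , j) = k ≤ i × l ≤ j

⊑⇒≤ₚ : ∀ {p q} → p ⊑ q → T (p ≤ₚ q)
⊑⇒≤ₚ (k≤i , l≤j) = from T-∧ (≤⇒≤ᵇ k≤i , ≤⇒≤ᵇ l≤j)

≤ₚ⇒⊑ : ∀ {k l i j} → T ((k , l) ≤ₚ (i , j)) → (k , l) ⊑ (i , j)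
≤ₚ⇒⊑ {k} {l} {i} {j} t = let k≤i , l≤j = to T-∧ t in ≤ᵇ⇒≤ k i k≤i , ≤ᵇ⇒≤ l j l≤j

≡ₚ-refl : ∀ p → T (p ≡ₚ p)
≡ₚ-refl (i , j) = from T-∧ (≡⇒≡ᵇ i i refl , ≡⇒≡ᵇ j j refl)

≡ₚ⇒≡ : ∀ {p q} → T (p ≡ₚ q) → p ≡ q
≡ₚ⇒≡ {k , l} {i , j} t = let k≡i , l≡j = to T-∧ t in cong₂ _,_ (≡ᵇ⇒≡ k i k≡i) (≡ᵇ⇒≡ l j l≡j)

_≟ₚ_ : DecidableEquality Pt
_≟ₚ_ = ≡-dec _≟_ _≟_

remove-self : ∀ p S → ¬ T (remove p S p)
remove-self p S t = to T-not (proj₁ (to T-∧ t)) (≡ₚ-refl p)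

remove⁺ : ∀ S {p q} → q ≢ p → T (S q) → T (remove p S q)
remove⁺ S q≢p s = from T-∧ (from T-not (λ e → q≢p (≡ₚ⇒≡ e)) , s)

remove⁻ : ∀ S {p q} → T (remove p S q) → q ≢ p × T (S q)
remove⁻ S {q = q} t = let n , s = to T-∧ t in (λ { refl → to T-not n (≡ₚ-refl q) }) , s

insert-self : ∀ p S → T (insert p S p)
insert-self p S = from T-∨ (inj₁ (≡ₚ-refl p))

insert⁺ : ∀ S {p q} → T (S q) → T (insert p S q)
insert⁺ S s = from T-∨ (inj₂ s)

insert⁻ : ∀ S {p q} → q ≢ p → T (insert p S q) → T (S q)
insert⁻ S q≢p t = [ (λ e → ⊥-elim (q≢p (≡ₚ⇒≡ e))) , id ] (to T-∨ t)

⊑-upperCover : ∀ {i j k l} → (i , j) ⊑ (k , l) → (k , l) ≢ (i , j) → k ≤ l →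
               (i , suc j) ⊑ (k , l) ⊎ ((suc i , j) ⊑ (k , l) × suc i ≤ j)
⊑-upperCover (i≤k , j≤l) r≢p k≤l with m≤n⇒m<n∨m≡n j≤l
... | inj₁ j<l = inj₁ (i≤k , j<l)
... | inj₂ refl with m≤n⇒m<n∨m≡n i≤k
...   | inj₁ i<k = inj₂ ((i<k , ≤-refl) , ≤-trans i<k k≤l)
...   | inj₂ refl = ⊥-elim (r≢p refl)

⊑-lowerCover : ∀ {x y k j} → (x , y) ⊑ (suc k , suc j) → (x , y) ≢ (suc k , suc j) →
               (x , y) ⊑ (suc k , j) ⊎ (x , y) ⊑ (k , suc j)
⊑-lowerCover (x≤ , y≤) q≢p with m≤n⇒m<n∨m≡n y≤
... | inj₁ (s≤s y≤j) = inj₁ (x≤ , y≤j)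
... | inj₂ refl with m≤n⇒m<n∨m≡n x≤
...   | inj₁ (s≤s x≤k) = inj₂ (x≤k , ≤-refl)
...   | inj₂ refl = ⊥-elim (q≢p refl)

range-bound : ∀ lo hi d → d < suc hi ∸ lo → lo ℕ.+ d ≤ hi
range-bound zero     hi       d (s≤s d≤hi) = d≤hi
range-bound (suc lo) zero     d d<0 with () ← subst (d <_) (0∸n≡0 lo) d<0
range-bound (suc lo) (suc hi) d d<        = s≤s (range-bound lo hi d d<)

∈-range⁺ : ∀ {lo hi k} → lo ≤ k → k ≤ hi → k ∈ range lo hi
∈-range⁺ {lo} {hi} lo≤k k≤hi =
  subst (_∈ range lo hi) (m+[n∸m]≡n lo≤k) (∈-map⁺ (lo ℕ.+_) (∈-upTo⁺ (∸-monoˡ-< (s≤s k≤hi) lo≤k)))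

∈-range⁻ : ∀ {lo hi k} → k ∈ range lo hi → lo ≤ k × k ≤ hi
∈-range⁻ {lo} {hi} k∈ with ∈-map⁻ (lo ℕ.+_) k∈
... | d , d∈ , refl = m≤m+n lo d , range-bound lo hi d (∈-upTo⁻ d∈)

module _ {a b : ℕ} where

  InT-downward : ∀ {r k l} → InT a b r → (k , l) ⊑ r → 1 ≤ k → k ≤ l → InT a b (k , l)
  InT-downward (_ , i≤a , _ , j≤) (k≤i , l≤j) 1≤k k≤l =
    1≤k , ≤-trans k≤i i≤a , k≤l , ≤-trans l≤j (≤-trans j≤ (∸-monoʳ-≤ (a ℕ.+ b) k≤i))

  InT-triangle : a ≤ b → ∀ {i j} → 1 ≤ i → i ≤ j → j ≤ a → InT a b (i , j)
  InT-triangle a≤b {i} 1≤i i≤j j≤a =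
    1≤i , ≤-trans i≤j j≤a , i≤j ,
    ≤-trans j≤a (subst (a ≤_) (sym (+-∸-assoc a (≤-trans (≤-trans i≤j j≤a) a≤b))) (m≤m+n a (b ∸ i)))

  private
    row : ℕ → List Pt
    row i = map (i ,_) (range i (a ℕ.+ b ∸ i))

  ∈-points⁺ : ∀ {p} → InT a b p → p ∈ points a b
  ∈-points⁺ (1≤i , i≤a , i≤j , j≤) = ∈-concatMap⁺ row (lose (∈-range⁺ 1≤i i≤a) (∈-map⁺ _ (∈-range⁺ i≤j j≤)))

  ∈-points⁻ : ∀ {p} → p ∈ points a b → InT a b p
  ∈-points⁻ p∈ with find (∈-concatMap⁻ row {xs = range 1 a} p∈)
  ... | i , i∈ , p∈row with ∈-map⁻ (_ ,_) p∈row
  ...   | j , j∈ , refl = let 1≤i , i≤a = ∈-range⁻ i∈ ; i≤j , j≤ = ∈-range⁻ j∈ in 1≤i , i≤a , i≤j , j≤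

  DownClosed : Subset → Set
  DownClosed S = ∀ {p q} → InT a b p → InT a b q → q ⊑ p → T (S p) → T (S q)

  isIdealᵇ⇔DownClosed : ∀ {S} → T (isIdealᵇ a b S) ⇔ DownClosed S
  isIdealᵇ⇔DownClosed = mk⇔
    (λ t {_} {_} p∈ q∈ q⊑p Sp →
      to T-not-∨ (All.lookup (all⁺ _ _ (to T-not-∨ (All.lookup (all⁺ _ _ t) (∈-points⁺ p∈)) Sp)) (∈-points⁺ q∈))
                 (⊑⇒≤ₚ q⊑p))
    (λ dc → all⁻ _ (All.tabulate λ p∈ → from T-not-∨ λ Sp → all⁻ _ (All.tabulate λ q∈ → from T-not-∨ λ q≤p →
      dc (∈-points⁻ p∈) (∈-points⁻ q∈) (≤ₚ⇒⊑ q≤p) Sp)))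

  module _ (I : Ideal a b) where

    mem⇒InT : ∀ {p} → T (mem I p) → InT a b p
    mem⇒InT {p} t = sub I p (to T-≡ t)

    mem-downward : ∀ {p q} → InT a b q → q ⊑ p → T (mem I p) → T (mem I q)
    mem-downward q∈ q⊑p t = to isIdealᵇ⇔DownClosed (closed I) (mem⇒InT t) q∈ q⊑p t

    mem-offTriangle : ∀ i → mem I (suc i , i) ≡ false
    mem-offTriangle i with mem I (suc i , i) in e
    ... | false = refl
    ... | true with () ← n≮n i (proj₁ (proj₂ (proj₂ (sub I _ e))))

    -- Row 0 counts as lying in the ideal, so that for i ≤ j the lower covers of (i , suc j)
    -- are uniformly (i , j) and (pred i , suc j).
    mem₀ : Pt → Bool
    mem₀ (k , l) = (k ≡ᵇ 0) ∨ mem I (k , l)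

    mem₀-intro : ∀ {k l} → (1 ≤ k → T (mem I (k , l))) → T (mem₀ (k , l))
    mem₀-intro {zero}  _ = tt
    mem₀-intro {suc k} t = t (s≤s z≤n)

    mem₀-downward : ∀ {q k l} → InT a b q → q ⊑ (k , l) → T (mem₀ (k , l)) → T (mem I q)
    mem₀-downward {k = zero}  (1≤x , _) (x≤0 , _) _ with () ← ≤-trans 1≤x x≤0
    mem₀-downward {k = suc k} q∈ q⊑p t = mem-downward q∈ q⊑p t

    isIdeal-remove : ∀ {i j} → InT a b (i , j) →
      isIdealᵇ a b (remove (i , j) (mem I)) ≡ not (mem I (i , suc j)) ∧ not (mem I (suc i , j))
    isIdeal-remove {i} {j} p∈@(1≤i , _ , i≤j , _) = T-⇔⇒≡ (mk⇔ necessary sufficient)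
      where
        necessary : T (isIdealᵇ a b (remove (i , j) (mem I))) → T (not (mem I (i , suc j)) ∧ not (mem I (suc i , j)))
        necessary t = from T-∧ (from T-not (blocked (λ ()) (≤-refl , n≤1+n j)) ,
                                from T-not (blocked (λ ()) (n≤1+n i , ≤-refl)))
          where
            blocked : ∀ {r} → r ≢ (i , j) → (i , j) ⊑ r → ¬ T (mem I r)
            blocked r≢p p⊑r t′ =
              remove-self (i , j) (mem I) (to isIdealᵇ⇔DownClosed t (mem⇒InT t′) p∈ p⊑r (remove⁺ (mem I) r≢p t′))

        sufficient : T (not (mem I (i , suc j)) ∧ not (mem I (suc i , j))) → T (isIdealᵇ a b (remove (i , j) (mem I)))
        sufficient t = from isIdealᵇ⇔DownClosed closure
          where
            closure : DownClosed (remove (i , j) (mem I))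
            closure {r} {q} r∈ q∈ q⊑r tr with remove⁻ (mem I) tr | q ≟ₚ (i , j)
            ... | _ , mr | no q≢p = remove⁺ (mem I) q≢p (mem-downward q∈ q⊑r mr)
            ... | r≢p , mr | yes refl with ⊑-upperCover q⊑r r≢p (proj₁ (proj₂ (proj₂ r∈)))
            ...   | inj₁ c⊑r = ⊥-elim (to T-not (proj₁ (to T-∧ t))
                      (mem-downward (InT-downward r∈ c⊑r 1≤i (≤-trans i≤j (n≤1+n j))) c⊑r mr))
            ...   | inj₂ (c⊑r , i<j) = ⊥-elim (to T-not (proj₂ (to T-∧ t))
                      (mem-downward (InT-downward r∈ c⊑r (s≤s z≤n) i<j) c⊑r mr))

    isIdeal-insert : ∀ {k j} → InT a b (suc k , suc j) → suc k ≤ j →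
      isIdealᵇ a b (insert (suc k , suc j) (mem I)) ≡ mem I (suc k , j) ∧ mem₀ (k , suc j)
    isIdeal-insert {k} {j} p∈ k<j = T-⇔⇒≡ (mk⇔ necessary sufficient)
      where
        p : Pt
        p = (suc k , suc j)

        necessary : T (isIdealᵇ a b (insert p (mem I))) → T (mem I (suc k , j) ∧ mem₀ (k , suc j))
        necessary t = from T-∧
          ( supported (≤-refl , n≤1+n j) (s≤s z≤n) k<j (λ e → 1+n≢n (sym (cong proj₂ e)))
          , mem₀-intro λ 1≤k → supported (n≤1+n k , ≤-refl) 1≤k k≤1+j (λ e → 1+n≢n (sym (cong proj₁ e))))
          where
            k≤1+j : k ≤ suc j
            k≤1+j = ≤-trans (n≤1+n k) (≤-trans k<j (n≤1+n j))
            supported : ∀ {x y} → (x , y) ⊑ p → 1 ≤ x → x ≤ y → (x , y) ≢ p → T (mem I (x , y))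
            supported q⊑p 1≤x x≤y q≢p = insert⁻ (mem I) q≢p
              (to isIdealᵇ⇔DownClosed t p∈ (InT-downward p∈ q⊑p 1≤x x≤y) q⊑p (insert-self p (mem I)))

        sufficient : T (mem I (suc k , j) ∧ mem₀ (k , suc j)) → T (isIdealᵇ a b (insert p (mem I)))
        sufficient t = from isIdealᵇ⇔DownClosed closure
          where
            closure : DownClosed (insert p (mem I))
            closure {r} {q} r∈ q∈ q⊑r tr with q ≟ₚ p | r ≟ₚ p
            ... | yes refl | _        = insert-self p (mem I)
            ... | no q≢p   | no r≢p   = insert⁺ (mem I) (mem-downward q∈ q⊑r (insert⁻ (mem I) r≢p tr))
            ... | no q≢p   | yes refl = insert⁺ (mem I)
                  ([ (λ q⊑c → mem-downward q∈ q⊑c (proj₁ (to T-∧ t)))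
                   , (λ q⊑c → mem₀-downward q∈ q⊑c (proj₂ (to T-∧ t))) ] (⊑-lowerCover q⊑r q≢p))

    Tminus≡maximal : ∀ {i j} → InT a b (i , j) →
      Tminus a b (i , j) I ≡ indicator (mem I (i , j) ∧ (not (mem I (i , suc j)) ∧ not (mem I (suc i , j))))
    Tminus≡maximal {i} {j} p∈ = cong (λ x → indicator (mem I (i , j) ∧ x)) (isIdeal-remove p∈)

    Tplus≡addable : ∀ {k j} → InT a b (suc k , suc j) → suc k ≤ j →
      Tplus a b (suc k , suc j) I ≡ indicator (not (mem I (suc k , suc j)) ∧ (mem I (suc k , j) ∧ mem₀ (k , suc j)))
    Tplus≡addable {k} {j} p∈ k<j = cong (λ x → indicator (not (mem I (suc k , suc j)) ∧ x)) (isIdeal-insert p∈ k<j)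

    corner : ℕ → ℕ → ℚ
    corner i j = indicator (not (mem₀ (pred i , suc j)) ∧ mem I (i , j))

    corner-belowDiagonal : ∀ i → corner (suc i) i ≡ 0ℚ
    corner-belowDiagonal i =
      cong indicator (trans (cong (not (mem₀ (i , suc i)) ∧_) (mem-offTriangle i)) (∧-zeroʳ _))

    corner-difference : a ≤ b → ∀ {i j} → 1 ≤ i → i ≤ j → j < a →
      Tminus a b (i , j) I - Tplus a b (i , suc j) I ≡ corner i j - corner (suc i) j
    corner-difference a≤b {suc k} {j} _ i≤j j<a =
      trans (cong₂ _-_ (Tminus≡maximal here∈) (Tplus≡addable right∈ i≤j))
            (indicator-identity _ _ _ _ (mem-downward here∈ (n≤1+n (suc k) , ≤-refl)) right⇒above)
      where
        here∈ : InT a b (suc k , j)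
        here∈ = InT-triangle a≤b (s≤s z≤n) i≤j (<⇒≤ j<a)
        right∈ : InT a b (suc k , suc j)
        right∈ = InT-triangle a≤b (s≤s z≤n) (≤-trans i≤j (n≤1+n j)) j<a
        right⇒above : T (mem I (suc k , suc j)) → T (mem₀ (k , suc j))
        right⇒above t = mem₀-intro λ 1≤k →
          mem-downward (InT-downward right∈ (n≤1+n k , ≤-refl) 1≤k (≤-trans (n≤1+n k) (≤-trans i≤j (n≤1+n j))))
                       (n≤1+n k , ≤-refl) t

    rowCorners : ℕ → ℚ
    rowCorners i = ∑ i (a ∸ i) (λ j → ℕtoℚ (a ∸ j) * corner i j)

    -- Each corner 1 j reduces to 0ℚ, since row 0 is full.
    rowCorners-first : rowCorners 1 ≡ 0ℚ
    rowCorners-first = trans (∑-cong 1 (a ∸ 1) λ j _ _ → ℚ.*-zeroʳ (ℕtoℚ (a ∸ j))) (∑-zero 1 (a ∸ 1))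

    rowCorners-last : rowCorners (suc a) ≡ 0ℚ
    rowCorners-last = cong (λ n → ∑ (suc a) n (λ j → ℕtoℚ (a ∸ j) * corner (suc a) j)) (m≤n⇒m∸n≡0 (n≤1+n a))

    corner-row : a ≤ b → ∀ {i} → 1 ≤ i → i ≤ a →
      ∑ i (a ∸ i) (λ j → ℕtoℚ (a ∸ j) * (Tminus a b (i , j) I - Tplus a b (i , suc j) I)) ≡
      rowCorners i - rowCorners (suc i)
    corner-row a≤b {i} 1≤i i≤a = begin
      ∑ i (a ∸ i) (λ j → w j * (Tminus a b (i , j) I - Tplus a b (i , suc j) I))
        ≡⟨ ∑-cong i (a ∸ i) (λ j i≤j j< → cong (w j *_)
             (corner-difference a≤b 1≤i i≤j (subst (j <_) (m+[n∸m]≡n i≤a) j<))) ⟩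
      ∑ i (a ∸ i) (λ j → w j * (corner i j - corner (suc i) j))
        ≡⟨ ∑-cong i (a ∸ i) (λ j _ _ → solve 3 (λ w x y → w :* (x :- y) := w :* x :- w :* y) refl (w j) _ _) ⟩
      ∑ i (a ∸ i) (λ j → w j * corner i j - w j * corner (suc i) j)
        ≡⟨ ∑-- _ _ i (a ∸ i) ⟩
      rowCorners i - ∑ i (a ∸ i) (λ j → w j * corner (suc i) j)
        ≡⟨ cong (rowCorners i -_) (∑-dropZeroHead _ i (a ∸ i)
             (trans (cong (w i *_) (corner-belowDiagonal i)) (ℚ.*-zeroʳ (w i)))) ⟩
      rowCorners i - ∑ (suc i) (pred (a ∸ i)) (λ j → w j * corner (suc i) j)
        ≡⟨ cong (λ n → rowCorners i - ∑ (suc i) n (λ j → w j * corner (suc i) j)) (pred[m∸n]≡m∸[1+n] a i) ⟩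
      rowCorners i - rowCorners (suc i) ∎
      where
        w : ℕ → ℚ
        w j = ℕtoℚ (a ∸ j)

diagonalMinus offDiagonalMinus weightedToggles : (a b : ℕ) → Ideal a b → ℚ
diagonalMinus    a b I = ∑ 1 a (λ i → ℕtoℚ (a ∸ i) * Tminus a b (i , i) I)
offDiagonalMinus a b I = ∑ 1 a (λ i → ∑ (suc i) (a ∸ i) (λ j → Tminus a b (i , j) I))
weightedToggles  a b I = ∑ 1 a (λ i → ∑ (suc i) (a ∸ i) (λ j → ℕtoℚ (suc a ∸ j) * Ttog a b (i , j) I))

module _ {a b : ℕ} (a≤b : a ≤ b) (I : Ideal a b) where

  row-identity : ∀ {i} → 1 ≤ i → i ≤ a →
    ℕtoℚ (a ∸ i) * Tminus a b (i , i) I - ∑ (suc i) (a ∸ i) (λ j → Tminus a b (i , j) I) ≡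
    ∑ (suc i) (a ∸ i) (λ j → ℕtoℚ (suc a ∸ j) * Ttog a b (i , j) I) + (rowCorners I i - rowCorners I (suc i))
  row-identity {i} 1≤i i≤a =
    trans (summation-by-parts (λ j → Tminus a b (i , j) I) (λ j → Tplus a b (i , j) I) a i (a ∸ i) refl)
          (cong (∑ (suc i) (a ∸ i) (λ j → ℕtoℚ (suc a ∸ j) * Ttog a b (i , j) I) +_) (corner-row I a≤b 1≤i i≤a))

  diagonal-offDiagonal≡weightedToggles : diagonalMinus a b I - offDiagonalMinus a b I ≡ weightedToggles a b I
  diagonal-offDiagonal≡weightedToggles = begin
    diagonalMinus a b I - offDiagonalMinus a b I
      ≡⟨ sym (∑-- _ _ 1 a) ⟩
    ∑ 1 a (λ i → ℕtoℚ (a ∸ i) * Tminus a b (i , i) I - ∑ (suc i) (a ∸ i) (λ j → Tminus a b (i , j) I))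
      ≡⟨ ∑-cong 1 a (λ i 1≤i i<1+a → row-identity 1≤i (≤-pred i<1+a)) ⟩
    ∑ 1 a (λ i → toggles i + (rowCorners I i - rowCorners I (suc i)))
      ≡⟨ ∑-+ toggles _ 1 a ⟩
    weightedToggles a b I + ∑ 1 a (λ i → rowCorners I i - rowCorners I (suc i))
      ≡⟨ cong (weightedToggles a b I +_) (∑-telescope (rowCorners I) 1 a) ⟩
    weightedToggles a b I + (rowCorners I 1 - rowCorners I (suc a))
      ≡⟨ cong₂ (λ x y → weightedToggles a b I + (x - y)) (rowCorners-first I) (rowCorners-last I) ⟩
    weightedToggles a b I + (0ℚ - 0ℚ)
      ≡⟨ ℚ.+-identityʳ _ ⟩
    weightedToggles a b I ∎
    where
      toggles : ℕ → ℚ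
      toggles i = ∑ (suc i) (a ∸ i) (λ j → ℕtoℚ (suc a ∸ j) * Ttog a b (i , j) I)

module _ {a b : ℕ} (μ : Dist a b) where

  diagSum≡E : diagSum a b μ ≡ E μ (diagonalMinus a b)
  diagSum≡E = begin
    diagSum a b μ
      ≡⟨ sumℚ-map-range _ 1 a ⟩
    ∑ 1 a (λ i → ℕtoℚ (a ∸ i) * E μ (Tminus a b (i , i)))
      ≡⟨ ∑-cong 1 a (λ i _ _ → sym (E-scale μ (ℕtoℚ (a ∸ i)) (Tminus a b (i , i)))) ⟩
    ∑ 1 a (λ i → E μ (λ I → ℕtoℚ (a ∸ i) * Tminus a b (i , i) I))
      ≡⟨ sym (E-∑ μ (λ i I → ℕtoℚ (a ∸ i) * Tminus a b (i , i) I) 1 a) ⟩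
    E μ (diagonalMinus a b) ∎

  offSum≡E : offSum a b μ ≡ E μ (offDiagonalMinus a b)
  offSum≡E = begin
    offSum a b μ
      ≡⟨ sumℚ-concatMap _ (range 1 a) ⟩
    sumℚ (map (λ i → sumℚ (map (λ j → E μ (Tminus a b (i , j))) (range (suc i) a))) (range 1 a))
      ≡⟨ sumℚ-map-range _ 1 a ⟩
    ∑ 1 a (λ i → sumℚ (map (λ j → E μ (Tminus a b (i , j))) (range (suc i) a)))
      ≡⟨ ∑-cong 1 a (λ i _ _ →
           trans (sumℚ-map-range _ (suc i) a) (sym (E-∑ μ (λ j → Tminus a b (i , j)) (suc i) (a ∸ i)))) ⟩
    ∑ 1 a (λ i → E μ (λ I → ∑ (suc i) (a ∸ i) (λ j → Tminus a b (i , j) I)))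
      ≡⟨ sym (E-∑ μ (λ i I → ∑ (suc i) (a ∸ i) (λ j → Tminus a b (i , j) I)) 1 a) ⟩
    E μ (offDiagonalMinus a b) ∎

  E-weightedToggles≡0 : a ≤ b → ToggleSymmetric a b μ → E μ (weightedToggles a b) ≡ 0ℚ
  E-weightedToggles≡0 a≤b symmetric =
    trans (E-∑ μ (λ i I → ∑ (suc i) (a ∸ i) (λ j → c j * Ttog a b (i , j) I)) 1 a)
          (trans (∑-cong 1 a row) (∑-zero 1 a))
    where
      c : ℕ → ℚ
      c j = ℕtoℚ (suc a ∸ j)
      row : ∀ i → 1 ≤ i → i < 1 ℕ.+ a → E μ (λ I → ∑ (suc i) (a ∸ i) (λ j → c j * Ttog a b (i , j) I)) ≡ 0ℚ
      row i 1≤i i<1+a =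
        trans (E-∑ μ (λ j I → c j * Ttog a b (i , j) I) (suc i) (a ∸ i))
              (trans (∑-cong (suc i) (a ∸ i) entry) (∑-zero (suc i) (a ∸ i)))
        where
          entry : ∀ j → suc i ≤ j → j < suc i ℕ.+ (a ∸ i) → E μ (λ I → c j * Ttog a b (i , j) I) ≡ 0ℚ
          entry j i<j j< = begin
            E μ (λ I → c j * Ttog a b (i , j) I)
              ≡⟨ E-scale μ (c j) (Ttog a b (i , j)) ⟩
            c j * E μ (Ttog a b (i , j))
              ≡⟨ cong (c j *_) (symmetric (i , j) (InT-triangle a≤b 1≤i (<⇒≤ i<j) j≤a)) ⟩
            c j * 0ℚ
              ≡⟨ ℚ.*-zeroʳ (c j) ⟩
            0ℚ ∎
            where
              j≤a : j ≤ a
              j≤a = ≤-pred (subst (j <_) (cong suc (m+[n∸m]≡n (≤-pred i<1+a))) j<)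

lemma6p9 : (a b : ℕ) → 1 ≤ a → a ≤ b → (μ : Dist a b) → IsProbability μ →
           ToggleSymmetric a b μ → diagSum a b μ - offSum a b μ ≡ 0ℚ
lemma6p9 a b _ a≤b μ _ symmetric = begin
  diagSum a b μ - offSum a b μ                             ≡⟨ cong₂ _-_ (diagSum≡E μ) (offSum≡E μ) ⟩
  E μ (diagonalMinus a b) - E μ (offDiagonalMinus a b)     ≡⟨ sym (E-- μ (diagonalMinus a b) (offDiagonalMinus a b)) ⟩
  E μ (λ I → diagonalMinus a b I - offDiagonalMinus a b I) ≡⟨ E-cong μ (diagonal-offDiagonal≡weightedToggles a≤b) ⟩
  E μ (weightedToggles a b)                                ≡⟨ E-weightedToggles≡0 μ a≤b symmetric ⟩
  0ℚ                                                       ∎
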